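{- Let $K$ be a real quadratic number field and let $\beta_1,\beta_2\in\mathfrak{O}_K^+$ be a $\mathbb{Z}$-basis of $\mathfrak{O}_K$ with $\beta_1<\beta_2$. If $m>1$ is an integer and $\alpha=(m+1)\beta_2-m\beta_1$, then $$\mathfrak{M}(\beta_1,\beta_2,\alpha)=\{(m-i)\beta_1+(i-1)\beta_2\mid i=1,\dots,m\},$$ and consequently $$\mathrm{Frob}(\beta_1,\beta_2,\alpha)=\bigcup_{i=1}^m\Big((m-i)\beta_1+(i-1)\beta_2+\big(C_\mathbb{Q}(\beta_1,\beta_2,\alpha)\cap\mathfrak{O}_K\big)\Big).$$
   Context: A real quadratic number field is a degree-2 number field contained in $\mathbb{R}$; $\mathfrak{O}_K$ is its ring of integers and $\mathfrak{O}_K^+=\mathfrak{O}_K\cap[0,\infty)$. $\mathbb{N}=\{0,1,2,\dots\}$. For $\alpha_1,\dots,\alpha_n\in\mathfrak{O}_K^+$: $\mathrm{SG}(\alpha_1,\dots,\alpha_n)=\{\sum x_i\alpha_i\mid x_i\in\mathbb{N}\}$; $C_\mathbb{Q}(\alpha_1,\dots,\alpha_n)=\{\sum x_i\alpha_i\mid x_i\in\mathbb{Q}_{\geqslant0}\}$; $\mathrm{Frob}(\alpha_1,\dots,\alpha_n)=\{w\in\mathrm{SG}(\alpha_1,\dots,\alpha_n)\mid w+(C_\mathbb{Q}(\alpha_1,\dots,\alpha_n)\cap\mathfrak{O}_K)\subseteq \mathrm{SG}(\alpha_1,\dots,\alpha_n)\}$. The partial order $\preccurlyeq$ on $\mathrm{Frob}(\alpha_1,\dots,\alpha_n)$: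 $w\preccurlyeq v$ iff $w+(C_\mathbb{Q}(\alpha_1,\dots,\alpha_n)\cap\mathfrak{O}_K)\subseteq v+(C_\mathbb{Q}(\alpha_1,\dots,\alpha_n)\cap\mathfrak{O}_K)$. $\mathfrak{M}(\alpha_1,\dots,\alpha_n)$ is the set of maximal elements of $\mathrm{Frob}(\alpha_1,\dots,\alpha_n)$ with respect to $\preccurlyeq$. -}

module Defs where

open import Data.Nat as ℕ using (ℕ; zero; suc)
open import Data.Nat.Divisibility using (_∣_)
open import Data.Nat.DivMod using (_%_)
open import Data.Integer as ℤ using (ℤ; +_)
open import Data.Rational as ℚ using (ℚ)
open import Data.Fin using (Fin; zero; suc)
open import Data.Product using (_×_; _,_; Σ; ∃; ∃-syntax)
open import Data.Sum using (_⊎_)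
open import Relation.Binary.PropositionalEquality using (_≡_; _≢_)

-- Real quadratic fields.
-- Every real quadratic field is K = ℚ(√d) ⊂ ℝ for a unique squarefree
-- integer d ≥ 2 (√d the positive real root).

SquareFree : ℕ → Set
SquareFree d = ∀ p → p ℕ.* p ∣ d → p ≡ 1

record RealQuadratic : Set where
  field
    d        : ℕ
    2≤d      : 2 ℕ.≤ d
    sqfree   : SquareFree d
open RealQuadratic public

-- ω = (1 + √d)/2 if d ≡ 1 (mod 4), ω = √d otherwise;  𝔒_K = ℤ ⊕ ℤω.
-- An element of 𝔒_K is represented by its coordinates (a , b) meaning a + bω.
-- An element of K is represented by (a , b) ∈ ℚ² meaning a + bω.

OK : Set
OK = ℤ × ℤ

Kf : Set
Kf = ℚ × ℚ

ι : OK → Kf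
ι (a , b) = (a ℚ./ 1 , b ℚ./ 1)

_⊕_ : OK → OK → OK
(a , b) ⊕ (c , e) = (a ℤ.+ c , b ℤ.+ e)

⊖_ : OK → OK
⊖ (a , b) = (ℤ.- a , ℤ.- b)

_⊝_ : OK → OK → OK
x ⊝ y = x ⊕ (⊖ y)

𝟘 : OK
𝟘 = (+ 0 , + 0)

_·ᶻ_ : ℤ → OK → OK
k ·ᶻ (a , b) = (k ℤ.* a , k ℤ.* b)

_·ⁿ_ : ℕ → OK → OK
n ·ⁿ x = (+ n) ·ᶻ x

_⊕K_ : Kf → Kf → Kf
(a , b) ⊕K (c , e) = (a ℚ.+ c , b ℚ.+ e)

_·K_ : ℚ → Kf → Kf
q ·K (a , b) = (q ℚ.* a , q ℚ.* b)

𝟘K : Kf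
𝟘K = (ℚ.0ℚ , ℚ.0ℚ)

-- u + v√d ≥ 0 (as a real number), for u v ∈ ℤ, d ≥ 0.
NonNegSurd : ℕ → ℤ → ℤ → Set
NonNegSurd d u v =
    (+ 0 ℤ.≤ u × + 0 ℤ.≤ v)
  ⊎ (+ 0 ℤ.≤ u × v ℤ.< + 0 × (+ d) ℤ.* (v ℤ.* v) ℤ.≤ u ℤ.* u)
  ⊎ (u ℤ.< + 0 × + 0 ℤ.< v × u ℤ.* u ℤ.≤ (+ d) ℤ.* (v ℤ.* v))

-- a + bω ≥ 0 as a real number.  If d ≡ 1 (mod 4) then
-- a + bω = ((2a + b) + b√d)/2, otherwise a + bω = a + b√d.
NonNeg : RealQuadratic → OK → Set
NonNeg K (a , b) with d K % 4
... | 1 = NonNegSurd (d K) (+ 2 ℤ.* a ℤ.+ b) b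
... | _ = NonNegSurd (d K) a b

InOK⁺ : RealQuadratic → OK → Set
InOK⁺ K x = NonNeg K x

_≤[_]_ : OK → RealQuadratic → OK → Set
x ≤[ K ] y = NonNeg K (y ⊝ x)

_<[_]_ : OK → RealQuadratic → OK → Set
x <[ K ] y = x ≤[ K ] y × x ≢ y

IsZBasis : OK → OK → Set
IsZBasis β₁ β₂ =
  ∀ (γ : OK) →
    (∃[ x ] ∃[ y ] γ ≡ (x ·ᶻ β₁) ⊕ (y ·ᶻ β₂))
  × (∀ x y x' y' → γ ≡ (x ·ᶻ β₁) ⊕ (y ·ᶻ β₂) → γ ≡ (x' ·ᶻ β₁) ⊕ (y' ·ᶻ β₂)
                 → x ≡ x' × y ≡ y')

ΣOK : ∀ {n} → (Fin n → OK) → OK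
ΣOK {zero}  f = 𝟘
ΣOK {suc n} f = f zero ⊕ ΣOK (λ i → f (suc i))

ΣK : ∀ {n} → (Fin n → Kf) → Kf
ΣK {zero}  f = 𝟘K
ΣK {suc n} f = f zero ⊕K ΣK (λ i → f (suc i))

SG : ∀ {n} → (Fin n → OK) → OK → Set
SG {n} α w = Σ (Fin n → ℕ) λ x → w ≡ ΣOK (λ i → x i ·ⁿ α i)

CQ : ∀ {n} → (Fin n → OK) → Kf → Set
CQ {n} α w = Σ (Fin n → ℚ) λ q → (∀ i → ℚ.0ℚ ℚ.≤ q i) × w ≡ ΣK (λ i → q i ·K ι (α i))

CQ∩OK : ∀ {n} → (Fin n → OK) → OK → Set
CQ∩OK α γ = CQ α (ι γ)

Frob : ∀ {n} → (Fin n → OK) → OK → Set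
Frob α w = SG α w × (∀ γ → CQ∩OK α γ → SG α (w ⊕ γ))

_≼[_]_ : ∀ {n} → OK → (Fin n → OK) → OK → Set
w ≼[ α ] v = ∀ γ → CQ∩OK α γ → ∃[ δ ] (CQ∩OK α δ × w ⊕ γ ≡ v ⊕ δ)

𝔐 : ∀ {n} → (Fin n → OK) → OK → Set
𝔐 α w = Frob α w × (∀ v → Frob α v → w ≼[ α ] v → v ≡ w)

triple : OK → OK → OK → Fin 3 → OK
triple a b c zero = a
triple a b c (suc zero) = b
triple a b c (suc (suc zero)) = c

{-# OPTIONS --safe #-}
module Submission where

-- In coordinates (x, y) with respect to the basis β₁, β₂ the generators are (1, 0), (0, 1) and
-- α = (-m, m + 1). The rational cone is spanned by (1, 0) and α and is cut out by y ≥ 0 and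
-- (m + 1) x + m y ≥ 0. A point (x, y) of the semigroup with y ≤ (m + 1) K + m uses α at most K
-- times, so x ≥ -m K. Shifting a candidate w by suitable cone vectors and reading off this bound
-- forces w to lie above one of the corners (m - i, i - 1); conversely every corner plus the cone
-- lies in the semigroup, by writing i - 1 + y = r + (m + 1) k. The corners differ by multiples of
-- (1, -1), none of which lies in the pointed cone, so they are exactly the maximal elements.

open import Defs
open import Data.Nat as ℕ using (ℕ; zero; suc; _∸_)
import Data.Nat.Properties as ℕP
open import Data.Integer as ℤ using (ℤ; +_; -[1+_]; 0ℤ; ∣_∣)
import Data.Integer.Properties as ℤP
open import Data.Integer.Tactic.RingSolver using (solve; solve-∀)
open import Data.Rational as ℚ using (ℚ; 0ℚ)
import Data.Rational.Properties as ℚP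
import Data.Rational.Unnormalised as ℚᵘ
import Data.Rational.Unnormalised.Properties as ℚᵘP
import Data.Rational.Solver as ℚSolver
open import Data.Fin using (Fin; zero; suc)
open import Data.List using (_∷_; [])
open import Data.Product using (_×_; _,_; proj₁; proj₂; ∃-syntax)
open import Data.Sum using (inj₁; inj₂)
open import Data.Empty using (⊥-elim)
open import Data.Nat.DivMod using (_%_; _/_; m≡m%n+[m/n]*n; m%n<n)
open import Relation.Nullary using (contradiction)
open import Relation.Binary.PropositionalEquality
open import Function.Bundles using (_⇔_; mk⇔; Equivalence)
open import Function.Construct.Composition using (_⇔-∘_)

fromℤ : ℤ → ℚ
fromℤ z = z ℚ./ 1

fromℤ≃ : ∀ z → ℚ.toℚᵘ (fromℤ z) ℚᵘ.≃ ℚᵘ.mkℚᵘ z 0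
fromℤ≃ z = ℚP.toℚᵘ-fromℚᵘ (ℚᵘ.mkℚᵘ z 0)

fromℤ-+ : ∀ a b → fromℤ (a ℤ.+ b) ≡ fromℤ a ℚ.+ fromℤ b
fromℤ-+ a b = ℚP.toℚᵘ-injective (begin
  ℚ.toℚᵘ (fromℤ (a ℤ.+ b))                 ≈⟨ fromℤ≃ (a ℤ.+ b) ⟩
  ℚᵘ.mkℚᵘ (a ℤ.+ b) 0                       ≈⟨ ℚᵘ.*≡* cross ⟩
  ℚᵘ.mkℚᵘ a 0 ℚᵘ.+ ℚᵘ.mkℚᵘ b 0              ≈⟨ ℚᵘP.+-cong (fromℤ≃ a) (fromℤ≃ b) ⟨
  ℚ.toℚᵘ (fromℤ a) ℚᵘ.+ ℚ.toℚᵘ (fromℤ b)   ≈⟨ ℚP.toℚᵘ-homo-+ (fromℤ a) (fromℤ b) ⟨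
  ℚ.toℚᵘ (fromℤ a ℚ.+ fromℤ b)             ∎)
  where
  open ℚᵘP.≃-Reasoning
  cross : (a ℤ.+ b) ℤ.* + 1 ≡ (a ℤ.* + 1 ℤ.+ b ℤ.* + 1) ℤ.* + 1
  cross = solve (a ∷ b ∷ [])

fromℤ-* : ∀ a b → fromℤ (a ℤ.* b) ≡ fromℤ a ℚ.* fromℤ b
fromℤ-* a b = ℚP.toℚᵘ-injective (begin
  ℚ.toℚᵘ (fromℤ (a ℤ.* b))                 ≈⟨ fromℤ≃ (a ℤ.* b) ⟩
  ℚᵘ.mkℚᵘ a 0 ℚᵘ.* ℚᵘ.mkℚᵘ b 0              ≈⟨ ℚᵘP.*-cong (fromℤ≃ a) (fromℤ≃ b) ⟨
  ℚ.toℚᵘ (fromℤ a) ℚᵘ.* ℚ.toℚᵘ (fromℤ b)   ≈⟨ ℚP.toℚᵘ-homo-* (fromℤ a) (fromℤ b) ⟨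
  ℚ.toℚᵘ (fromℤ a ℚ.* fromℤ b)             ∎)
  where open ℚᵘP.≃-Reasoning

fromℤ-nonNeg : ∀ {z} → 0ℤ ℤ.≤ z → 0ℚ ℚ.≤ fromℤ z
fromℤ-nonNeg (ℤ.+≤+ {n = n} _) = ℚP.nonNegative⁻¹ (fromℤ (+ n)) {{ℚP.normalize-nonNeg n 1}}

fromℤ-nonNeg⁻¹ : ∀ {z} → 0ℚ ℚ.≤ fromℤ z → 0ℤ ℤ.≤ z
fromℤ-nonNeg⁻¹ {+ n}      _  = ℤ.+≤+ ℕ.z≤n
fromℤ-nonNeg⁻¹ { -[1+ n ]} 0≤ = ⊥-elim (ℚP.nonNeg≢neg q q {{ℚ.nonNegative 0≤}} {{q<0}} refl)
  where
  q : ℚ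
  q = fromℤ -[1+ n ]
  q<0 : ℚ.Negative q
  q<0 = ℚP.neg-pos {ℚ.normalize (suc n) 1} (ℚP.normalize-pos (suc n) 1)

_∙_ : ℤ × ℤ → OK → ℤ
(l₁ , l₂) ∙ (u , v) = u ℤ.* l₁ ℤ.+ v ℤ.* l₂

_∙ℚ_ : ℤ × ℤ → Kf → ℚ
(l₁ , l₂) ∙ℚ (u , v) = u ℚ.* fromℤ l₁ ℚ.+ v ℚ.* fromℤ l₂

module QS = ℚSolver.+-*-Solver

∙ℚ-ι : ∀ l γ → l ∙ℚ ι γ ≡ fromℤ (l ∙ γ)
∙ℚ-ι (l₁ , l₂) (u , v) = sym (trans (fromℤ-+ (u ℤ.* l₁) (v ℤ.* l₂)) (cong₂ ℚ._+_ (fromℤ-* u l₁) (fromℤ-* v l₂)))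

∙ℚ-⊕K : ∀ l u v → l ∙ℚ (u ⊕K v) ≡ l ∙ℚ u ℚ.+ l ∙ℚ v
∙ℚ-⊕K (l₁ , l₂) (a , b) (c , e) = QS.solve 6
  (λ a b c e l₁ l₂ → (a QS.:+ c) QS.:* l₁ QS.:+ (b QS.:+ e) QS.:* l₂
                     QS.:= (a QS.:* l₁ QS.:+ b QS.:* l₂) QS.:+ (c QS.:* l₁ QS.:+ e QS.:* l₂))
  refl a b c e (fromℤ l₁) (fromℤ l₂)

∙ℚ-·K : ∀ l q u → l ∙ℚ (q ·K u) ≡ q ℚ.* (l ∙ℚ u)
∙ℚ-·K (l₁ , l₂) q (a , b) = QS.solve 5
  (λ q a b l₁ l₂ → (q QS.:* a) QS.:* l₁ QS.:+ (q QS.:* b) QS.:* l₂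
                   QS.:= q QS.:* (a QS.:* l₁ QS.:+ b QS.:* l₂))
  refl q a b (fromℤ l₁) (fromℤ l₂)

0≤*ℚ : ∀ {p q} → 0ℚ ℚ.≤ p → 0ℚ ℚ.≤ q → 0ℚ ℚ.≤ p ℚ.* q
0≤*ℚ {p} {q} 0≤p 0≤q = ℚP.nonNegative⁻¹ (p ℚ.* q)
  {{ℚP.nonNeg*nonNeg⇒nonNeg p {{ℚ.nonNegative 0≤p}} q {{ℚ.nonNegative 0≤q}}}}

∙ℚ-ΣK-nonNeg : ∀ {n} l (f : Fin n → Kf) → (∀ i → 0ℚ ℚ.≤ l ∙ℚ f i) → 0ℚ ℚ.≤ l ∙ℚ ΣK f
∙ℚ-ΣK-nonNeg {zero}  (l₁ , l₂) f _ =
  ℚP.≤-reflexive (sym (cong₂ ℚ._+_ (ℚP.*-zeroˡ (fromℤ l₁)) (ℚP.*-zeroˡ (fromℤ l₂))))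
∙ℚ-ΣK-nonNeg {suc n} l f 0≤f = subst (0ℚ ℚ.≤_) (sym (∙ℚ-⊕K l (f zero) (ΣK (λ i → f (suc i)))))
  (ℚP.+-mono-≤ (0≤f zero) (∙ℚ-ΣK-nonNeg l (λ i → f (suc i)) (λ i → 0≤f (suc i))))

∙-nonNeg-on-cone : ∀ {n} (α : Fin n → OK) l {γ} →
                   (∀ i → 0ℤ ℤ.≤ l ∙ α i) → CQ∩OK α γ → 0ℤ ℤ.≤ l ∙ γ
∙-nonNeg-on-cone α l {γ} 0≤lα (q , 0≤q , ιγ≡) = fromℤ-nonNeg⁻¹ (subst (0ℚ ℚ.≤_) lγ≡ 0≤sum)
  where
  0≤sum : 0ℚ ℚ.≤ l ∙ℚ ΣK (λ i → q i ·K ι (α i))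
  0≤sum = ∙ℚ-ΣK-nonNeg l _ λ i → subst (0ℚ ℚ.≤_)
    (sym (trans (∙ℚ-·K l (q i) (ι (α i))) (cong (q i ℚ.*_) (∙ℚ-ι l (α i)))))
    (0≤*ℚ (0≤q i) (fromℤ-nonNeg (0≤lα i)))
  lγ≡ : l ∙ℚ ΣK (λ i → q i ·K ι (α i)) ≡ fromℤ (l ∙ γ)
  lγ≡ = trans (cong (l ∙ℚ_) (sym ιγ≡)) (∙ℚ-ι l γ)

∙-linear : ∀ s t f g w → ((s ·ᶻ f) ⊕ (t ·ᶻ g)) ∙ w ≡ s ℤ.* (f ∙ w) ℤ.+ t ℤ.* (g ∙ w)
∙-linear s t (f₁ , f₂) (g₁ , g₂) (u , v) = expand
  where
  expand : u ℤ.* (s ℤ.* f₁ ℤ.+ t ℤ.* g₁) ℤ.+ v ℤ.* (s ℤ.* f₂ ℤ.+ t ℤ.* g₂)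
           ≡ s ℤ.* (u ℤ.* f₁ ℤ.+ v ℤ.* f₂) ℤ.+ t ℤ.* (u ℤ.* g₁ ℤ.+ v ℤ.* g₂)
  expand = solve (s ∷ t ∷ f₁ ∷ f₂ ∷ g₁ ∷ g₂ ∷ u ∷ v ∷ [])

module Coordinates {β₁ β₂ : OK} (basis : IsZBasis β₁ β₂) where

  lin : ℤ → ℤ → OK
  lin x y = (x ·ᶻ β₁) ⊕ (y ·ᶻ β₂)

  lin-⊕ : ∀ x y x' y' → lin x y ⊕ lin x' y' ≡ lin (x ℤ.+ x') (y ℤ.+ y')
  lin-⊕ x y x' y' = cong₂ _,_ (distrib (proj₁ β₁) (proj₁ β₂)) (distrib (proj₂ β₁) (proj₂ β₂))
    where
    distrib : ∀ b₁ b₂ → (x ℤ.* b₁ ℤ.+ y ℤ.* b₂) ℤ.+ (x' ℤ.* b₁ ℤ.+ y' ℤ.* b₂)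
                        ≡ (x ℤ.+ x') ℤ.* b₁ ℤ.+ (y ℤ.+ y') ℤ.* b₂
    distrib b₁ b₂ = solve (x ∷ y ∷ x' ∷ y' ∷ b₁ ∷ b₂ ∷ [])

  ·ᶻ-lin : ∀ k x y → k ·ᶻ lin x y ≡ lin (k ℤ.* x) (k ℤ.* y)
  ·ᶻ-lin k x y = cong₂ _,_ (distrib (proj₁ β₁) (proj₁ β₂)) (distrib (proj₂ β₁) (proj₂ β₂))
    where
    distrib : ∀ b₁ b₂ → k ℤ.* (x ℤ.* b₁ ℤ.+ y ℤ.* b₂) ≡ (k ℤ.* x) ℤ.* b₁ ℤ.+ (k ℤ.* y) ℤ.* b₂
    distrib b₁ b₂ = solve (k ∷ x ∷ y ∷ b₁ ∷ b₂ ∷ [])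

  lin-injective : ∀ {x y x' y'} → lin x y ≡ lin x' y' → x ≡ x' × y ≡ y'
  lin-injective {x} {y} {x'} {y'} eq = proj₂ (basis (lin x y)) x y x' y' refl eq

  -- the inverse basis matrix: the coordinates of 1 and of ω
  private
    coords-1 : ∃[ x ] ∃[ y ] (+ 1 , 0ℤ) ≡ lin x y
    coords-1 = proj₁ (basis (+ 1 , 0ℤ))
    coords-ω : ∃[ x ] ∃[ y ] (0ℤ , + 1) ≡ lin x y
    coords-ω = proj₁ (basis (0ℤ , + 1))

  x* y* : ℤ × ℤ
  x* = proj₁ coords-1 , proj₁ coords-ω
  y* = proj₁ (proj₂ coords-1) , proj₁ (proj₂ coords-ω)

  lin-∙ : ∀ w → w ≡ lin (x* ∙ w) (y* ∙ w)
  lin-∙ (g₁ , g₂) = sym (begin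
    lin (g₁ ℤ.* a ℤ.+ g₂ ℤ.* c) (g₁ ℤ.* b ℤ.+ g₂ ℤ.* e)
      ≡⟨ sym (lin-⊕ (g₁ ℤ.* a) (g₁ ℤ.* b) (g₂ ℤ.* c) (g₂ ℤ.* e)) ⟩
    lin (g₁ ℤ.* a) (g₁ ℤ.* b) ⊕ lin (g₂ ℤ.* c) (g₂ ℤ.* e)
      ≡⟨ sym (cong₂ _⊕_ (·ᶻ-lin g₁ a b) (·ᶻ-lin g₂ c e)) ⟩
    (g₁ ·ᶻ lin a b) ⊕ (g₂ ·ᶻ lin c e)
      ≡⟨ sym (cong₂ (λ u v → (g₁ ·ᶻ u) ⊕ (g₂ ·ᶻ v)) (proj₂ (proj₂ coords-1)) (proj₂ (proj₂ coords-ω))) ⟩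
    (g₁ ·ᶻ (+ 1 , 0ℤ)) ⊕ (g₂ ·ᶻ (0ℤ , + 1))
      ≡⟨ cong₂ _,_ first second ⟩
    (g₁ , g₂) ∎)
    where
    open ≡-Reasoning
    first : g₁ ℤ.* + 1 ℤ.+ g₂ ℤ.* 0ℤ ≡ g₁
    first = solve (g₁ ∷ g₂ ∷ [])
    second : g₁ ℤ.* 0ℤ ℤ.+ g₂ ℤ.* + 1 ≡ g₂
    second = solve (g₁ ∷ g₂ ∷ [])
    a b c e : ℤ
    a = proj₁ x*
    c = proj₂ x*
    b = proj₁ y*
    e = proj₂ y*

  ∙-lin : ∀ s t x y → ((s ·ᶻ x*) ⊕ (t ·ᶻ y*)) ∙ lin x y ≡ s ℤ.* x ℤ.+ t ℤ.* y
  ∙-lin s t x y = trans (∙-linear s t x* y* (lin x y))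
    (cong₂ (λ u v → s ℤ.* u ℤ.+ t ℤ.* v) (sym (proj₁ coordinates)) (sym (proj₂ coordinates)))
    where
    coordinates : x ≡ x* ∙ lin x y × y ≡ y* ∙ lin x y
    coordinates = lin-injective (lin-∙ (lin x y))

  coords-elim : (P : OK → Set) → (∀ x y → P (lin x y)) → ∀ w → P w
  coords-elim P f w = subst P (sym (lin-∙ w)) (f (x* ∙ w) (y* ∙ w))

⊕-assoc : ∀ u v w → (u ⊕ v) ⊕ w ≡ u ⊕ (v ⊕ w)
⊕-assoc (a , b) (c , e) (f , g) = cong₂ _,_ (ℤP.+-assoc a c f) (ℤP.+-assoc b e g)

⊕-identityʳ : ∀ u → u ⊕ 𝟘 ≡ u
⊕-identityʳ (a , b) = cong₂ _,_ (ℤP.+-identityʳ a) (ℤP.+-identityʳ b)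

𝔐-of-corners :
  ∀ {n} (α : Fin n → OK) (m : ℕ) (corner : ℕ → OK) →
  CQ∩OK α 𝟘 →
  (∀ γ δ → CQ∩OK α γ → CQ∩OK α δ → CQ∩OK α (γ ⊕ δ)) →
  (∀ w → Frob α w ⇔ (∃[ i ] (1 ℕ.≤ i × i ℕ.≤ m × ∃[ γ ] (CQ∩OK α γ × w ≡ corner i ⊕ γ)))) →
  (∀ {i j γ δ} → 1 ℕ.≤ i → i ℕ.≤ m → 1 ℕ.≤ j → j ℕ.≤ m → CQ∩OK α γ → CQ∩OK α δ →
     corner i ≡ (corner j ⊕ γ) ⊕ δ → i ≡ j × γ ≡ 𝟘) →
  ∀ w → 𝔐 α w ⇔ (∃[ i ] (1 ℕ.≤ i × i ℕ.≤ m × w ≡ corner i))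
𝔐-of-corners α m corner cone-𝟘 cone-⊕ frob⇔ corners-rigid w = mk⇔ maximal⇒corner corner⇒maximal
  where
  corner-frob : ∀ {i} → 1 ℕ.≤ i → i ℕ.≤ m → Frob α (corner i)
  corner-frob {i} 1≤i i≤m = Equivalence.from (frob⇔ (corner i))
    (i , 1≤i , i≤m , 𝟘 , cone-𝟘 , sym (⊕-identityʳ (corner i)))

  maximal⇒corner : 𝔐 α w → ∃[ i ] (1 ℕ.≤ i × i ℕ.≤ m × w ≡ corner i)
  maximal⇒corner (frob-w , maximal) with Equivalence.to (frob⇔ w) frob-w
  ... | i , 1≤i , i≤m , γ , γ∈C , w≡ =
    i , 1≤i , i≤m , sym (maximal (corner i) (corner-frob 1≤i i≤m) w≼corner)
    where
    w≼corner : w ≼[ α ] corner i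
    w≼corner γ' γ'∈C = γ ⊕ γ' , cone-⊕ γ γ' γ∈C γ'∈C ,
      trans (cong (_⊕ γ') w≡) (⊕-assoc (corner i) γ γ')

  corner⇒maximal : ∃[ i ] (1 ℕ.≤ i × i ℕ.≤ m × w ≡ corner i) → 𝔐 α w
  corner⇒maximal (i , 1≤i , i≤m , refl) = corner-frob 1≤i i≤m , maximal
    where
    maximal : ∀ v → Frob α v → corner i ≼[ α ] v → v ≡ corner i
    maximal v frob-v corner≼v with Equivalence.to (frob⇔ v) frob-v | corner≼v 𝟘 cone-𝟘
    ... | j , 1≤j , j≤m , γ , γ∈C , v≡ | δ , δ∈C , corner≡ with
          corners-rigid 1≤i i≤m 1≤j j≤m γ∈C δ∈C
            (trans (sym (⊕-identityʳ (corner i))) (trans corner≡ (cong (_⊕ δ) v≡)))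
    ... | refl , refl = trans v≡ (⊕-identityʳ (corner i))

pos-∸ : ∀ {n k} → n ℕ.≤ k → + (k ∸ n) ≡ + k ℤ.- + n
pos-∸ {n} {k} n≤k = trans (sym (ℤP.≤-⊖ n≤k)) (sym (ℤP.[+m]-[+n]≡m⊖n k n))

+-nonNeg : ∀ {a b} → 0ℤ ℤ.≤ a → 0ℤ ℤ.≤ b → 0ℤ ℤ.≤ a ℤ.+ b
+-nonNeg = ℤP.+-mono-≤

*-nonNeg : ∀ {a b} → 0ℤ ℤ.≤ a → 0ℤ ℤ.≤ b → 0ℤ ℤ.≤ a ℤ.* b
*-nonNeg (ℤ.+≤+ {n = a} _) (ℤ.+≤+ {n = b} _) = subst (0ℤ ℤ.≤_) (ℤP.pos-* a b) (ℤ.+≤+ ℕ.z≤n)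

pos-nonNeg : ∀ n → 0ℤ ℤ.≤ + n
pos-nonNeg n = ℤ.+≤+ ℕ.z≤n

nonNeg-sum≡0 : ∀ {a b} → 0ℤ ℤ.≤ a → 0ℤ ℤ.≤ b → a ℤ.+ b ≡ 0ℤ → a ≡ 0ℤ
nonNeg-sum≡0 (ℤ.+≤+ {n = a} _) (ℤ.+≤+ _) a+b≡0 = cong +_ (ℕP.m+n≡0⇒m≡0 a (ℤP.+-injective a+b≡0))

quotient-bound : ∀ m {k K} → suc m ℕ.* k ℕ.≤ suc m ℕ.* K ℕ.+ m → k ℕ.≤ K
quotient-bound m {k} {K} bound = ℕ.s≤s⁻¹ (ℕP.*-cancelˡ-< (suc m) k (suc K)
  (subst (suc (suc m ℕ.* k) ℕ.≤_) (sym (ℕP.*-suc (suc m) K))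
    (ℕ.s≤s (ℕP.≤-trans bound (ℕP.≤-reflexive (ℕP.+-comm (suc m ℕ.* K) m))))))

-- (x, y) stands for x β₁ + y β₂: then α = (-m, m + 1) and p β₁ + q β₂ + k α = (p - m k, q + (m + 1) k)
module Lattice (m : ℕ) where

  open ≡-Reasoning

  M M₁ : ℤ
  M = + m
  M₁ = + suc m

  record InCone (x y : ℤ) : Set where
    constructor _,_
    field
      height-nonNeg : 0ℤ ℤ.≤ y
      slope-nonNeg  : 0ℤ ℤ.≤ M₁ ℤ.* x ℤ.+ M ℤ.* y

  InSemigroup : ℤ → ℤ → Set
  InSemigroup x y = ∃[ p ] ∃[ q ] ∃[ k ] (x ≡ + p ℤ.- M ℤ.* + k × y ≡ + q ℤ.+ M₁ ℤ.* + k)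

  IsFrobenius : ℤ → ℤ → Set
  IsFrobenius x y = ∀ x' y' → InCone x' y' → InSemigroup (x ℤ.+ x') (y ℤ.+ y')

  AboveCorner : ℤ → ℤ → Set
  AboveCorner x y = ∃[ i ] (1 ℕ.≤ i × i ℕ.≤ m × InCone (x ℤ.- + (m ∸ i)) (y ℤ.- + (i ∸ 1)))

  InCone-0 : InCone 0ℤ 0ℤ
  InCone-0 = ℤP.≤-refl , ℤP.≤-reflexive (sym (cong₂ ℤ._+_ (ℤP.*-zeroʳ M₁) (ℤP.*-zeroʳ M)))

  InCone-+ : ∀ {x y x' y'} → InCone x y → InCone x' y' → InCone (x ℤ.+ x') (y ℤ.+ y')
  InCone-+ {x} {y} {x'} {y'} (0≤y , 0≤ℓ) (0≤y' , 0≤ℓ') =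
    +-nonNeg 0≤y 0≤y' , subst (0ℤ ℤ.≤_) (distrib M x y x' y') (+-nonNeg 0≤ℓ 0≤ℓ')
    where
    distrib : ∀ μ x y x' y' → ((+ 1 ℤ.+ μ) ℤ.* x ℤ.+ μ ℤ.* y) ℤ.+ ((+ 1 ℤ.+ μ) ℤ.* x' ℤ.+ μ ℤ.* y')
                              ≡ (+ 1 ℤ.+ μ) ℤ.* (x ℤ.+ x') ℤ.+ μ ℤ.* (y ℤ.+ y')
    distrib = solve-∀

  M₁-cancel : ∀ {z} → 0ℤ ℤ.≤ M₁ ℤ.* z → 0ℤ ℤ.≤ z
  M₁-cancel {z} 0≤M₁z = ℤP.*-cancelˡ-≤-pos 0ℤ z M₁ (subst (ℤ._≤ M₁ ℤ.* z) (sym (ℤP.*-zeroʳ M₁)) 0≤M₁z)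

  -- the integers strictly between -(m+1) and 0 are not multiples of m + 1
  M₁-cancel-+M : ∀ {z} → 0ℤ ℤ.≤ M₁ ℤ.* z ℤ.+ M → 0ℤ ℤ.≤ z
  M₁-cancel-+M {+ n}      _ = pos-nonNeg n
  M₁-cancel-+M { -[1+ n ]} 0≤ = contradiction (ℤP.≤-trans 0≤ ≤-1) λ ()
    where
    ≤-1 : M₁ ℤ.* -[1+ n ] ℤ.+ M ℤ.≤ -[1+ 0 ]
    ≤-1 = ℤP.≤-trans (ℤP.+-monoˡ-≤ M (ℤP.*-monoˡ-≤-nonNeg M₁ (ℤ.-≤- ℕ.z≤n)))
                     (ℤP.≤-reflexive (minus-one M))
      where
      minus-one : ∀ μ → (+ 1 ℤ.+ μ) ℤ.* -[1+ 0 ] ℤ.+ μ ≡ -[1+ 0 ]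
      minus-one = solve-∀

  InSemigroup-y-nonNeg : ∀ {x y} → InSemigroup x y → 0ℤ ℤ.≤ y
  InSemigroup-y-nonNeg (p , q , k , _ , refl) = +-nonNeg (pos-nonNeg q) (*-nonNeg (pos-nonNeg (suc m)) (pos-nonNeg k))

  -- a semigroup point of height at most (m + 1) K + m uses α at most K times
  InSemigroup-x-bound : ∀ {x y} K → InSemigroup x y → y ℤ.≤ M₁ ℤ.* + K ℤ.+ M → 0ℤ ℤ.≤ x ℤ.+ M ℤ.* + K
  InSemigroup-x-bound K (p , q , k , refl , refl) y≤ = subst (0ℤ ℤ.≤_) (sym x+MK≡)
    (+-nonNeg (pos-nonNeg p) (*-nonNeg (pos-nonNeg m) (pos-nonNeg (K ∸ k))))
    where
    lhs≡ : + q ℤ.+ M₁ ℤ.* + k ≡ + (q ℕ.+ suc m ℕ.* k)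
    lhs≡ = trans (cong (ℤ._+_ (+ q)) (sym (ℤP.pos-* (suc m) k))) (sym (ℤP.pos-+ q _))
    rhs≡ : M₁ ℤ.* + K ℤ.+ M ≡ + (suc m ℕ.* K ℕ.+ m)
    rhs≡ = trans (cong (ℤ._+ M) (sym (ℤP.pos-* (suc m) K))) (sym (ℤP.pos-+ _ m))
    k≤K : k ℕ.≤ K
    k≤K = quotient-bound m (ℕP.≤-trans (ℕP.m≤n+m _ q) (ℤP.drop‿+≤+ (subst₂ ℤ._≤_ lhs≡ rhs≡ y≤)))
    shift : ∀ μ p k K → (p ℤ.- μ ℤ.* k) ℤ.+ μ ℤ.* K ≡ p ℤ.+ μ ℤ.* (K ℤ.- k)
    shift = solve-∀
    x+MK≡ : (+ p ℤ.- M ℤ.* + k) ℤ.+ M ℤ.* + K ≡ + p ℤ.+ M ℤ.* + (K ∸ k)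
    x+MK≡ = trans (shift M (+ p) (+ k) (+ K)) (cong (λ e → + p ℤ.+ M ℤ.* e) (sym (pos-∸ k≤K)))

  pos-divMod : ∀ t → + t ≡ + (t % suc m) ℤ.+ M₁ ℤ.* + (t / suc m)
  pos-divMod t = begin
    + t                                         ≡⟨ cong +_ (m≡m%n+[m/n]*n t (suc m)) ⟩
    + (t % suc m ℕ.+ t / suc m ℕ.* suc m)       ≡⟨ ℤP.pos-+ (t % suc m) _ ⟩
    + (t % suc m) ℤ.+ + (t / suc m ℕ.* suc m)   ≡⟨ cong (ℤ._+_ (+ (t % suc m))) (ℤP.pos-* (t / suc m) (suc m)) ⟩
    + (t % suc m) ℤ.+ + (t / suc m) ℤ.* M₁      ≡⟨ cong (ℤ._+_ (+ (t % suc m))) (ℤP.*-comm (+ (t / suc m)) M₁) ⟩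
    + (t % suc m) ℤ.+ M₁ ℤ.* + (t / suc m)      ∎

  corner-shift-x-nonNeg : ∀ {i x t r k} → 1 ℕ.≤ i → i ℕ.≤ m → r ℕ.≤ m → InCone x (+ t) →
    + (i ∸ 1) ℤ.+ + t ≡ + r ℤ.+ M₁ ℤ.* + k → 0ℤ ℤ.≤ + (m ∸ i) ℤ.+ x ℤ.+ M ℤ.* + k
  corner-shift-x-nonNeg {i} {x} {t} {r} {k} 1≤i i≤m r≤m (_ , 0≤ℓ) y≡ = M₁-cancel-+M (subst (0ℤ ℤ.≤_) (sym M₁Z+M≡)
    (+-nonNeg (+-nonNeg 0≤ℓ (*-nonNeg (pos-nonNeg m) (pos-nonNeg (m ∸ r)))) (pos-nonNeg (m ∸ i))))
    where
    main : ℤ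
    main = (M₁ ℤ.* x ℤ.+ M ℤ.* + t) ℤ.+ M ℤ.* (M ℤ.- + r) ℤ.+ (M ℤ.- + i)
    expand : ∀ μ I R T x K → (+ 1 ℤ.+ μ) ℤ.* ((μ ℤ.- I) ℤ.+ x ℤ.+ μ ℤ.* K) ℤ.+ μ
           ≡ ((+ 1 ℤ.+ μ) ℤ.* x ℤ.+ μ ℤ.* T) ℤ.+ μ ℤ.* (μ ℤ.- R) ℤ.+ (μ ℤ.- I)
             ℤ.+ μ ℤ.* ((R ℤ.+ (+ 1 ℤ.+ μ) ℤ.* K) ℤ.- ((I ℤ.- + 1) ℤ.+ T))
    expand = solve-∀
    drop-zero : ∀ a μ b → a ℤ.+ μ ℤ.* (b ℤ.- b) ≡ a
    drop-zero = solve-∀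
    M₁Z+M≡ : M₁ ℤ.* (+ (m ∸ i) ℤ.+ x ℤ.+ M ℤ.* + k) ℤ.+ M
             ≡ (M₁ ℤ.* x ℤ.+ M ℤ.* + t) ℤ.+ M ℤ.* + (m ∸ r) ℤ.+ + (m ∸ i)
    M₁Z+M≡ = begin
      M₁ ℤ.* (+ (m ∸ i) ℤ.+ x ℤ.+ M ℤ.* + k) ℤ.+ M
        ≡⟨ cong (λ e → M₁ ℤ.* (e ℤ.+ x ℤ.+ M ℤ.* + k) ℤ.+ M) (pos-∸ i≤m) ⟩
      M₁ ℤ.* ((M ℤ.- + i) ℤ.+ x ℤ.+ M ℤ.* + k) ℤ.+ M
        ≡⟨ expand M (+ i) (+ r) (+ t) x (+ k) ⟩
      main ℤ.+ M ℤ.* ((+ r ℤ.+ M₁ ℤ.* + k) ℤ.- ((+ i ℤ.- + 1) ℤ.+ + t))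
        ≡⟨ cong (λ e → main ℤ.+ M ℤ.* ((+ r ℤ.+ M₁ ℤ.* + k) ℤ.- (e ℤ.+ + t))) (sym (pos-∸ 1≤i)) ⟩
      main ℤ.+ M ℤ.* ((+ r ℤ.+ M₁ ℤ.* + k) ℤ.- (+ (i ∸ 1) ℤ.+ + t))
        ≡⟨ cong (λ e → main ℤ.+ M ℤ.* ((+ r ℤ.+ M₁ ℤ.* + k) ℤ.- e)) y≡ ⟩
      main ℤ.+ M ℤ.* ((+ r ℤ.+ M₁ ℤ.* + k) ℤ.- (+ r ℤ.+ M₁ ℤ.* + k))
        ≡⟨ drop-zero main M (+ r ℤ.+ M₁ ℤ.* + k) ⟩
      main
        ≡⟨ cong₂ (λ u v → (M₁ ℤ.* x ℤ.+ M ℤ.* + t) ℤ.+ M ℤ.* u ℤ.+ v) (sym (pos-∸ r≤m)) (sym (pos-∸ i≤m)) ⟩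
      (M₁ ℤ.* x ℤ.+ M ℤ.* + t) ℤ.+ M ℤ.* + (m ∸ r) ℤ.+ + (m ∸ i) ∎

  corner-isFrobenius : ∀ {i} → 1 ℕ.≤ i → i ℕ.≤ m → IsFrobenius (+ (m ∸ i)) (+ (i ∸ 1))
  corner-isFrobenius {i} 1≤i i≤m x .(+ t) xt∈C@(ℤ.+≤+ {n = t} _ , _) = ∣ Z ∣ , r , k , x≡ , y≡
    where
    r k : ℕ
    r = (i ∸ 1 ℕ.+ t) % suc m
    k = (i ∸ 1 ℕ.+ t) / suc m
    y≡ : + (i ∸ 1) ℤ.+ + t ≡ + r ℤ.+ M₁ ℤ.* + k
    y≡ = trans (sym (ℤP.pos-+ (i ∸ 1) t)) (pos-divMod (i ∸ 1 ℕ.+ t))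
    Z : ℤ
    Z = + (m ∸ i) ℤ.+ x ℤ.+ M ℤ.* + k
    0≤Z : 0ℤ ℤ.≤ Z
    0≤Z = corner-shift-x-nonNeg 1≤i i≤m (ℕ.s≤s⁻¹ (m%n<n (i ∸ 1 ℕ.+ t) (suc m))) xt∈C y≡
    add-sub : ∀ a b → a ≡ (a ℤ.+ b) ℤ.- b
    add-sub = solve-∀
    x≡ : + (m ∸ i) ℤ.+ x ≡ + ∣ Z ∣ ℤ.- M ℤ.* + k
    x≡ = trans (add-sub (+ (m ∸ i) ℤ.+ x) (M ℤ.* + k)) (cong (ℤ._- M ℤ.* + k) (sym (ℤP.0≤i⇒+∣i∣≡i 0≤Z)))

  isFrobenius⇒InSemigroup : ∀ {x y} → IsFrobenius x y → InSemigroup x y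
  isFrobenius⇒InSemigroup {x} {y} frob =
    subst₂ InSemigroup (ℤP.+-identityʳ x) (ℤP.+-identityʳ y) (frob 0ℤ 0ℤ InCone-0)

  aboveCorner⇒isFrobenius : ∀ {x y} → AboveCorner x y → IsFrobenius x y
  aboveCorner⇒isFrobenius {x} {y} (i , 1≤i , i≤m , above) x' y' x'y'∈C =
    subst₂ InSemigroup (regroup (+ (m ∸ i)) x x') (regroup (+ (i ∸ 1)) y y')
      (corner-isFrobenius 1≤i i≤m (x ℤ.- + (m ∸ i) ℤ.+ x') (y ℤ.- + (i ∸ 1) ℤ.+ y') (InCone-+ above x'y'∈C))
    where
    regroup : ∀ c x x' → c ℤ.+ ((x ℤ.- c) ℤ.+ x') ≡ x ℤ.+ x'
    regroup = solve-∀

  InCone-of-bound : ∀ {X} K {ε} → 0ℤ ℤ.≤ ε → 0ℤ ℤ.≤ X ℤ.+ M ℤ.* + K → InCone X (M₁ ℤ.* + K ℤ.+ ε)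
  InCone-of-bound {X} K {ε} 0≤ε 0≤X+MK =
    +-nonNeg (*-nonNeg (pos-nonNeg (suc m)) (pos-nonNeg K)) 0≤ε ,
    subst (0ℤ ℤ.≤_) (regroup M X (+ K) ε)
      (+-nonNeg (*-nonNeg (pos-nonNeg (suc m)) 0≤X+MK) (*-nonNeg (pos-nonNeg m) 0≤ε))
    where
    regroup : ∀ μ X K ε → (+ 1 ℤ.+ μ) ℤ.* (X ℤ.+ μ ℤ.* K) ℤ.+ μ ℤ.* ε
                        ≡ (+ 1 ℤ.+ μ) ℤ.* X ℤ.+ μ ℤ.* ((+ 1 ℤ.+ μ) ℤ.* K ℤ.+ ε)
    regroup = solve-∀

  -- write y = r + (m + 1) K with 0 ≤ r ≤ m; the corner is i = r + 1, or i = m when r = m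
  isFrobenius⇒aboveCorner-at : 1 ℕ.≤ m → ∀ {x} r K → r ℕ.≤ m →
    IsFrobenius x (+ r ℤ.+ M₁ ℤ.* + K) → AboveCorner x (+ r ℤ.+ M₁ ℤ.* + K)
  isFrobenius⇒aboveCorner-at 1≤m {x} r K r≤m frob with ℕP.m≤n⇒m<n∨m≡n r≤m
  ... | inj₁ r<m = suc r , ℕ.s≤s ℕ.z≤n , r<m ,
      subst (InCone X) (sym y-r≡) (InCone-of-bound K ℤP.≤-refl
        (InSemigroup-x-bound K (frob _ _ γ∈C) (ℤP.≤-reflexive y+m-r≡)))
    where
    X : ℤ
    X = x ℤ.- + (m ∸ suc r)
    γ∈C : InCone (ℤ.- + (m ∸ suc r)) (+ (m ∸ r))
    γ∈C = pos-nonNeg (m ∸ r) , subst (0ℤ ℤ.≤_) (sym ℓ≡) (pos-nonNeg (suc r))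
      where
      ℓ-identity : ∀ μ R → (+ 1 ℤ.+ μ) ℤ.* ℤ.- (μ ℤ.- (+ 1 ℤ.+ R)) ℤ.+ μ ℤ.* (μ ℤ.- R) ≡ + 1 ℤ.+ R
      ℓ-identity = solve-∀
      ℓ≡ : M₁ ℤ.* ℤ.- + (m ∸ suc r) ℤ.+ M ℤ.* + (m ∸ r) ≡ + suc r
      ℓ≡ = trans (cong₂ (λ u v → M₁ ℤ.* ℤ.- u ℤ.+ M ℤ.* v) (pos-∸ r<m) (pos-∸ r≤m)) (ℓ-identity M (+ r))
    y+m-r≡ : (+ r ℤ.+ M₁ ℤ.* + K) ℤ.+ + (m ∸ r) ≡ M₁ ℤ.* + K ℤ.+ M
    y+m-r≡ = trans (cong (ℤ._+_ (+ r ℤ.+ M₁ ℤ.* + K)) (pos-∸ r≤m)) (identity (+ r) (M₁ ℤ.* + K) M)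
      where
      identity : ∀ r a μ → (r ℤ.+ a) ℤ.+ (μ ℤ.- r) ≡ a ℤ.+ μ
      identity = solve-∀
    y-r≡ : (+ r ℤ.+ M₁ ℤ.* + K) ℤ.- + r ≡ M₁ ℤ.* + K ℤ.+ 0ℤ
    y-r≡ = identity (+ r) (M₁ ℤ.* + K)
      where
      identity : ∀ r a → (r ℤ.+ a) ℤ.- r ≡ a ℤ.+ 0ℤ
      identity = solve-∀
  ... | inj₂ refl = m , 1≤m , ℕP.≤-refl ,
      subst₂ InCone (sym x-0≡) (sym y-m+1≡) (InCone-of-bound K (pos-nonNeg 1)
        (InSemigroup-x-bound K (isFrobenius⇒InSemigroup {x} {M ℤ.+ M₁ ℤ.* + K} frob) (ℤP.≤-reflexive (ℤP.+-comm M (M₁ ℤ.* + K)))))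
    where
    x-0≡ : x ℤ.- + (m ∸ m) ≡ x
    x-0≡ = trans (cong (λ e → x ℤ.- + e) (ℕP.n∸n≡0 m)) (ℤP.+-identityʳ x)
    y-m+1≡ : (M ℤ.+ M₁ ℤ.* + K) ℤ.- + (m ∸ 1) ≡ M₁ ℤ.* + K ℤ.+ + 1
    y-m+1≡ = trans (cong (ℤ._-_ (M ℤ.+ M₁ ℤ.* + K)) (pos-∸ 1≤m)) (identity M (M₁ ℤ.* + K))
      where
      identity : ∀ μ a → (μ ℤ.+ a) ℤ.- (μ ℤ.- + 1) ≡ a ℤ.+ + 1
      identity = solve-∀

  isFrobenius⇒aboveCorner : 1 ℕ.≤ m → ∀ {x y} → IsFrobenius x y → AboveCorner x y
  isFrobenius⇒aboveCorner 1≤m {x} {y} frob with InSemigroup-y-nonNeg (isFrobenius⇒InSemigroup {x} {y} frob)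
  ... | ℤ.+≤+ {n = t} _ = subst (λ y → IsFrobenius x y → AboveCorner x y) (sym (pos-divMod t))
          (isFrobenius⇒aboveCorner-at 1≤m {x} (t % suc m) (t / suc m) (ℕ.s≤s⁻¹ (m%n<n t (suc m)))) frob

  InCone-x-nonNeg : ∀ {x y} → InCone x y → y ≡ 0ℤ → 0ℤ ℤ.≤ x
  InCone-x-nonNeg {x} (_ , 0≤ℓ) refl = M₁-cancel (subst (0ℤ ℤ.≤_) ℓ≡ 0≤ℓ)
    where
    ℓ≡ : M₁ ℤ.* x ℤ.+ M ℤ.* 0ℤ ≡ M₁ ℤ.* x
    ℓ≡ = trans (cong (ℤ._+_ (M₁ ℤ.* x)) (ℤP.*-zeroʳ M)) (ℤP.+-identityʳ (M₁ ℤ.* x))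

  InCone-pointed : ∀ {x y x' y'} → InCone x y → InCone x' y' →
                   x ℤ.+ x' ≡ 0ℤ → y ℤ.+ y' ≡ 0ℤ → x ≡ 0ℤ × y ≡ 0ℤ
  InCone-pointed {x} {y} {x'} {y'} xy∈C@(0≤y , _) x'y'∈C@(0≤y' , _) x+x'≡0 y+y'≡0 =
    nonNeg-sum≡0 (InCone-x-nonNeg xy∈C y≡0) (InCone-x-nonNeg x'y'∈C y'≡0) x+x'≡0 , y≡0
    where
    y≡0 : y ≡ 0ℤ
    y≡0 = nonNeg-sum≡0 0≤y 0≤y' y+y'≡0
    y'≡0 : y' ≡ 0ℤ
    y'≡0 = nonNeg-sum≡0 0≤y' 0≤y (trans (ℤP.+-comm y' y) y+y'≡0)

  InCone-antidiagonal : ∀ {I J} → InCone (J ℤ.- I) (I ℤ.- J) → I ≡ J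
  InCone-antidiagonal {I} {J} (0≤I-J , 0≤ℓ) =
    ℤP.≤-antisym (ℤP.0≤i-j⇒j≤i (subst (0ℤ ℤ.≤_) (ℓ≡ M I J) 0≤ℓ)) (ℤP.0≤i-j⇒j≤i 0≤I-J)
    where
    ℓ≡ : ∀ μ I J → (+ 1 ℤ.+ μ) ℤ.* (J ℤ.- I) ℤ.+ μ ℤ.* (I ℤ.- J) ≡ J ℤ.- I
    ℓ≡ = solve-∀

  corners-rigid : ∀ {i j gx gy dx dy} → 1 ℕ.≤ i → i ℕ.≤ m → 1 ℕ.≤ j → j ℕ.≤ m →
    InCone gx gy → InCone dx dy →
    + (m ∸ i) ≡ (+ (m ∸ j) ℤ.+ gx) ℤ.+ dx → + (i ∸ 1) ≡ (+ (j ∸ 1) ℤ.+ gy) ℤ.+ dy →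
    i ≡ j × gx ≡ 0ℤ × gy ≡ 0ℤ
  corners-rigid {i} {j} {gx} {gy} {dx} {dy} 1≤i i≤m 1≤j j≤m g∈C d∈C x≡ y≡ =
    ℤP.+-injective i≡j , InCone-pointed g∈C d∈C (trans gx+dx≡ (ℤP.i≡j⇒i-j≡0 (sym i≡j)))
                                                (trans gy+dy≡ (ℤP.i≡j⇒i-j≡0 i≡j))
    where
    isolate : ∀ c g d → g ℤ.+ d ≡ ((c ℤ.+ g) ℤ.+ d) ℤ.- c
    isolate = solve-∀
    difference : ∀ c a b → (c ℤ.- a) ℤ.- (c ℤ.- b) ≡ b ℤ.- a
    difference = solve-∀
    shifted : ∀ a b c → (a ℤ.- c) ℤ.- (b ℤ.- c) ≡ a ℤ.- b
    shifted = solve-∀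
    gx+dx≡ : gx ℤ.+ dx ≡ + j ℤ.- + i
    gx+dx≡ = begin
      gx ℤ.+ dx                           ≡⟨ isolate (+ (m ∸ j)) gx dx ⟩
      ((+ (m ∸ j) ℤ.+ gx) ℤ.+ dx) ℤ.- + (m ∸ j) ≡⟨ cong (ℤ._- + (m ∸ j)) (sym x≡) ⟩
      + (m ∸ i) ℤ.- + (m ∸ j)             ≡⟨ cong₂ ℤ._-_ (pos-∸ i≤m) (pos-∸ j≤m) ⟩
      (M ℤ.- + i) ℤ.- (M ℤ.- + j)          ≡⟨ difference M (+ i) (+ j) ⟩
      + j ℤ.- + i                         ∎
    gy+dy≡ : gy ℤ.+ dy ≡ + i ℤ.- + j
    gy+dy≡ = begin
      gy ℤ.+ dy                           ≡⟨ isolate (+ (j ∸ 1)) gy dy ⟩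
      ((+ (j ∸ 1) ℤ.+ gy) ℤ.+ dy) ℤ.- + (j ∸ 1) ≡⟨ cong (ℤ._- + (j ∸ 1)) (sym y≡) ⟩
      + (i ∸ 1) ℤ.- + (j ∸ 1)             ≡⟨ cong₂ ℤ._-_ (pos-∸ 1≤i) (pos-∸ 1≤j) ⟩
      (+ i ℤ.- + 1) ℤ.- (+ j ℤ.- + 1)      ≡⟨ shifted (+ i) (+ j) (+ 1) ⟩
      + i ℤ.- + j                         ∎
    i≡j : + i ≡ + j
    i≡j = InCone-antidiagonal (subst₂ InCone gx+dx≡ gy+dy≡ (InCone-+ g∈C d∈C))

module Triple {β₁ β₂ : OK} (basis : IsZBasis β₁ β₂) (m : ℕ) where

  open Coordinates basis
  open Lattice m
  open ≡-Reasoning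

  α : OK
  α = ((+ (ℕ.suc m)) ·ᶻ β₂) ⊝ ((+ m) ·ᶻ β₁)

  gens : Fin 3 → OK
  gens = triple β₁ β₂ α

  corner : ℕ → OK
  corner i = ((m ∸ i) ·ⁿ β₁) ⊕ ((i ∸ 1) ·ⁿ β₂)

  β₁≡ : β₁ ≡ lin (+ 1) 0ℤ
  β₁≡ = cong₂ _,_ (identity (proj₁ β₁) (proj₁ β₂)) (identity (proj₂ β₁) (proj₂ β₂))
    where
    identity : ∀ b c → b ≡ + 1 ℤ.* b ℤ.+ 0ℤ ℤ.* c
    identity = solve-∀

  β₂≡ : β₂ ≡ lin 0ℤ (+ 1)
  β₂≡ = cong₂ _,_ (identity (proj₁ β₁) (proj₁ β₂)) (identity (proj₂ β₁) (proj₂ β₂))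
    where
    identity : ∀ b c → c ≡ 0ℤ ℤ.* b ℤ.+ + 1 ℤ.* c
    identity = solve-∀

  α≡ : α ≡ lin (ℤ.- M) M₁
  α≡ = cong₂ _,_ (identity M (proj₁ β₁) (proj₁ β₂)) (identity M (proj₂ β₁) (proj₂ β₂))
    where
    identity : ∀ μ b c → (+ 1 ℤ.+ μ) ℤ.* c ℤ.+ ℤ.- (μ ℤ.* b) ≡ ℤ.- μ ℤ.* b ℤ.+ (+ 1 ℤ.+ μ) ℤ.* c
    identity = solve-∀

  𝟘≡ : 𝟘 ≡ lin 0ℤ 0ℤ
  𝟘≡ = cong₂ _,_ (identity (proj₁ β₁) (proj₁ β₂)) (identity (proj₂ β₁) (proj₂ β₂))
    where
    identity : ∀ b c → 0ℤ ≡ 0ℤ ℤ.* b ℤ.+ 0ℤ ℤ.* c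
    identity = solve-∀

  ΣOK-gens : ∀ (f : Fin 3 → ℕ) → ΣOK (λ i → f i ·ⁿ gens i) ≡ lin (+ f zero ℤ.- M ℤ.* + f (suc (suc zero)))
                                                   (+ f (suc zero) ℤ.+ M₁ ℤ.* + f (suc (suc zero)))
  ΣOK-gens f = cong₂ _,_ (collect M p q k (proj₁ β₁) (proj₁ β₂)) (collect M p q k (proj₂ β₁) (proj₂ β₂))
    where
    p q k : ℤ
    p = + f zero
    q = + f (suc zero)
    k = + f (suc (suc zero))
    collect : ∀ μ p q k b c →
      p ℤ.* b ℤ.+ (q ℤ.* c ℤ.+ (k ℤ.* ((+ 1 ℤ.+ μ) ℤ.* c ℤ.+ ℤ.- (μ ℤ.* b)) ℤ.+ 0ℤ))
      ≡ (p ℤ.- μ ℤ.* k) ℤ.* b ℤ.+ (q ℤ.+ (+ 1 ℤ.+ μ) ℤ.* k) ℤ.* c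
    collect = solve-∀

  SG-lin : ∀ x y → SG gens (lin x y) ⇔ InSemigroup x y
  SG-lin x y = mk⇔ to from
    where
    to : SG gens (lin x y) → InSemigroup x y
    to (f , eq) = f zero , f (suc zero) , f (suc (suc zero)) , lin-injective (trans eq (ΣOK-gens f))
    from : InSemigroup x y → SG gens (lin x y)
    from (p , q , k , x≡ , y≡) = f , trans (cong₂ lin x≡ y≡) (sym (ΣOK-gens f))
      where
      f : Fin 3 → ℕ
      f zero = p
      f (suc zero) = q
      f (suc (suc zero)) = k

  cone-functional : ∀ s t {x y} → 0ℤ ℤ.≤ s → 0ℤ ℤ.≤ t → 0ℤ ℤ.≤ s ℤ.* ℤ.- M ℤ.+ t ℤ.* M₁ →
                    CQ∩OK gens (lin x y) → 0ℤ ℤ.≤ s ℤ.* x ℤ.+ t ℤ.* y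
  cone-functional s t {x} {y} 0≤s 0≤t 0≤value-α γ∈C =
    subst (0ℤ ℤ.≤_) (∙-lin s t x y) (∙-nonNeg-on-cone gens F {lin x y} on-gens γ∈C)
    where
    F : ℤ × ℤ
    F = (s ·ᶻ x*) ⊕ (t ·ᶻ y*)
    value : ∀ {w} a b → w ≡ lin a b → F ∙ w ≡ s ℤ.* a ℤ.+ t ℤ.* b
    value a b refl = ∙-lin s t a b
    first : ∀ s t → s ℤ.* + 1 ℤ.+ t ℤ.* 0ℤ ≡ s
    first = solve-∀
    second : ∀ s t → s ℤ.* 0ℤ ℤ.+ t ℤ.* + 1 ≡ t
    second = solve-∀
    on-gens : ∀ i → 0ℤ ℤ.≤ F ∙ gens i
    on-gens zero = subst (0ℤ ℤ.≤_) (sym (trans (value (+ 1) 0ℤ β₁≡) (first s t))) 0≤s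
    on-gens (suc zero) = subst (0ℤ ℤ.≤_) (sym (trans (value 0ℤ (+ 1) β₂≡) (second s t))) 0≤t
    on-gens (suc (suc zero)) = subst (0ℤ ℤ.≤_) (sym (value (ℤ.- M) M₁ α≡)) 0≤value-α

  instance
    M₁ℚ-positive : ℚ.Positive (fromℤ M₁)
    M₁ℚ-positive = ℚP.normalize-pos (suc m) 1
    M₁ℚ-nonZero : ℚ.NonZero (fromℤ M₁)
    M₁ℚ-nonZero = ℚP.pos⇒nonZero (fromℤ M₁)

  CQ-lin : ∀ x y → CQ∩OK gens (lin x y) ⇔ InCone x y
  CQ-lin x y = mk⇔ to from
    where
    to : CQ∩OK gens (lin x y) → InCone x y
    to γ∈C = subst (0ℤ ℤ.≤_) (height x y)
               (cone-functional 0ℤ (+ 1) {x} {y} ℤP.≤-refl (pos-nonNeg 1)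
                 (subst (0ℤ ℤ.≤_) (sym (height-α M)) (pos-nonNeg (suc m))) γ∈C) ,
             cone-functional M₁ M {x} {y} (pos-nonNeg (suc m)) (pos-nonNeg m)
               (ℤP.≤-reflexive (sym (slope-α M))) γ∈C
      where
      height : ∀ x y → 0ℤ ℤ.* x ℤ.+ + 1 ℤ.* y ≡ y
      height = solve-∀
      height-α : ∀ μ → 0ℤ ℤ.* ℤ.- μ ℤ.+ + 1 ℤ.* (+ 1 ℤ.+ μ) ≡ + 1 ℤ.+ μ
      height-α = solve-∀
      slope-α : ∀ μ → (+ 1 ℤ.+ μ) ℤ.* ℤ.- μ ℤ.+ μ ℤ.* (+ 1 ℤ.+ μ) ≡ 0ℤ
      slope-α = solve-∀

    inv : ℚ
    inv = ℚ.1/ fromℤ M₁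

    -- x β₁ + y β₂ = ((m + 1) x + m y)/(m + 1) · β₁ + y/(m + 1) · α
    q : Fin 3 → ℚ
    q zero = fromℤ (M₁ ℤ.* x ℤ.+ M ℤ.* y) ℚ.* inv
    q (suc zero) = 0ℚ
    q (suc (suc zero)) = fromℤ y ℚ.* inv

    from : InCone x y → CQ∩OK gens (lin x y)
    from (0≤y , 0≤ℓ) = q , 0≤q , cong₂ _,_ (component (proj₁ β₁) (proj₁ β₂)) (component (proj₂ β₁) (proj₂ β₂))
      where
      0≤inv : 0ℚ ℚ.≤ inv
      0≤inv = ℚP.nonNegative⁻¹ inv {{ℚP.pos⇒nonNeg inv {{ℚP.1/pos⇒pos (fromℤ M₁)}}}}
      0≤q : ∀ i → 0ℚ ℚ.≤ q i
      0≤q zero = 0≤*ℚ (fromℤ-nonNeg 0≤ℓ) 0≤inv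
      0≤q (suc zero) = ℚP.≤-refl
      0≤q (suc (suc zero)) = 0≤*ℚ (fromℤ-nonNeg 0≤y) 0≤inv
      regroup : ∀ μ x y b c → (+ 1 ℤ.+ μ) ℤ.* (x ℤ.* b ℤ.+ y ℤ.* c)
                            ≡ ((+ 1 ℤ.+ μ) ℤ.* x ℤ.+ μ ℤ.* y) ℤ.* b ℤ.+ y ℤ.* ((+ 1 ℤ.+ μ) ℤ.* c ℤ.+ ℤ.- (μ ℤ.* b))
      regroup = solve-∀
      component : ∀ b c → fromℤ (x ℤ.* b ℤ.+ y ℤ.* c)
        ≡ q zero ℚ.* fromℤ b ℚ.+ (q (suc zero) ℚ.* fromℤ c ℚ.+
            (q (suc (suc zero)) ℚ.* fromℤ (M₁ ℤ.* c ℤ.+ ℤ.- (M ℤ.* b)) ℚ.+ 0ℚ))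
      component b c = begin
        fromℤ (x ℤ.* b ℤ.+ y ℤ.* c)                            ≡⟨ ℚP.*-identityˡ _ ⟨
        ℚ.1ℚ ℚ.* fromℤ (x ℤ.* b ℤ.+ y ℤ.* c)                   ≡⟨ cong (ℚ._* _) (ℚP.*-inverseˡ (fromℤ M₁)) ⟨
        (inv ℚ.* fromℤ M₁) ℚ.* fromℤ (x ℤ.* b ℤ.+ y ℤ.* c)     ≡⟨ ℚP.*-assoc inv _ _ ⟩
        inv ℚ.* (fromℤ M₁ ℚ.* fromℤ (x ℤ.* b ℤ.+ y ℤ.* c))     ≡⟨ cong (inv ℚ.*_) (fromℤ-* M₁ (x ℤ.* b ℤ.+ y ℤ.* c)) ⟨
        inv ℚ.* fromℤ (M₁ ℤ.* (x ℤ.* b ℤ.+ y ℤ.* c))           ≡⟨ cong (λ e → inv ℚ.* fromℤ e) (regroup M x y b c) ⟩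
        inv ℚ.* fromℤ (ℓ ℤ.* b ℤ.+ y ℤ.* a)                    ≡⟨ cong (inv ℚ.*_) (fromℤ-+ (ℓ ℤ.* b) (y ℤ.* a)) ⟩
        inv ℚ.* (fromℤ (ℓ ℤ.* b) ℚ.+ fromℤ (y ℤ.* a))          ≡⟨ cong₂ (λ u v → inv ℚ.* (u ℚ.+ v)) (fromℤ-* ℓ b) (fromℤ-* y a) ⟩
        inv ℚ.* (fromℤ ℓ ℚ.* fromℤ b ℚ.+ fromℤ y ℚ.* fromℤ a)  ≡⟨ expand inv (fromℤ ℓ) (fromℤ b) (fromℤ c) (fromℤ y) (fromℤ a) ⟩
        (fromℤ ℓ ℚ.* inv) ℚ.* fromℤ b ℚ.+ (0ℚ ℚ.* fromℤ c ℚ.+ ((fromℤ y ℚ.* inv) ℚ.* fromℤ a ℚ.+ 0ℚ)) ∎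
        where
        ℓ a : ℤ
        ℓ = M₁ ℤ.* x ℤ.+ M ℤ.* y
        a = M₁ ℤ.* c ℤ.+ ℤ.- (M ℤ.* b)
        expand : ∀ i L B C Y A → i ℚ.* (L ℚ.* B ℚ.+ Y ℚ.* A)
                               ≡ (L ℚ.* i) ℚ.* B ℚ.+ (0ℚ ℚ.* C ℚ.+ ((Y ℚ.* i) ℚ.* A ℚ.+ 0ℚ))
        expand = QS.solve 6 (λ i L B C Y A → i QS.:* (L QS.:* B QS.:+ Y QS.:* A)
                   QS.:= (L QS.:* i) QS.:* B QS.:+ (QS.con 0ℚ QS.:* C QS.:+ ((Y QS.:* i) QS.:* A QS.:+ QS.con 0ℚ))) refl

  Frob-lin : ∀ x y → Frob gens (lin x y) ⇔ IsFrobenius x y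
  Frob-lin x y = mk⇔ to from
    where
    to : Frob gens (lin x y) → IsFrobenius x y
    to (_ , shifted) x' y' x'y'∈C = Equivalence.to (SG-lin (x ℤ.+ x') (y ℤ.+ y'))
      (subst (SG gens) (lin-⊕ x y x' y') (shifted (lin x' y') (Equivalence.from (CQ-lin x' y') x'y'∈C)))
    shifts : IsFrobenius x y → ∀ γ → CQ∩OK gens γ → SG gens (lin x y ⊕ γ)
    shifts frob = coords-elim (λ γ → CQ∩OK gens γ → SG gens (lin x y ⊕ γ)) λ x' y' γ∈C →
      subst (SG gens) (sym (lin-⊕ x y x' y'))
        (Equivalence.from (SG-lin (x ℤ.+ x') (y ℤ.+ y')) (frob x' y' (Equivalence.to (CQ-lin x' y') γ∈C)))
    from : IsFrobenius x y → Frob gens (lin x y)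
    from frob = Equivalence.from (SG-lin x y) (isFrobenius⇒InSemigroup {x} {y} frob) , shifts frob

  AboveCorner-lin : ∀ x y → AboveCorner x y ⇔
    (∃[ i ] (1 ℕ.≤ i × i ℕ.≤ m × ∃[ γ ] (CQ∩OK gens γ × lin x y ≡ corner i ⊕ γ)))
  AboveCorner-lin x y = mk⇔ to from
    where
    split : ∀ c x → x ≡ c ℤ.+ (x ℤ.- c)
    split = solve-∀
    to : AboveCorner x y → ∃[ i ] (1 ℕ.≤ i × i ℕ.≤ m × ∃[ γ ] (CQ∩OK gens γ × lin x y ≡ corner i ⊕ γ))
    to (i , 1≤i , i≤m , above) = i , 1≤i , i≤m , lin gx gy , Equivalence.from (CQ-lin gx gy) above ,
      trans (cong₂ lin (split (+ (m ∸ i)) x) (split (+ (i ∸ 1)) y)) (sym (lin-⊕ (+ (m ∸ i)) (+ (i ∸ 1)) gx gy))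
      where
      gx gy : ℤ
      gx = x ℤ.- + (m ∸ i)
      gy = y ℤ.- + (i ∸ 1)
    from : ∃[ i ] (1 ℕ.≤ i × i ℕ.≤ m × ∃[ γ ] (CQ∩OK gens γ × lin x y ≡ corner i ⊕ γ)) → AboveCorner x y
    from (i , 1≤i , i≤m , γ , γ∈C , x≡) = coords-elim
      (λ γ → CQ∩OK gens γ → lin x y ≡ corner i ⊕ γ → AboveCorner x y) above γ γ∈C x≡
      where
      above : ∀ gx gy → CQ∩OK gens (lin gx gy) → lin x y ≡ corner i ⊕ lin gx gy → AboveCorner x y
      above gx gy γ∈C x≡ = i , 1≤i , i≤m ,
        subst₂ InCone (isolate (+ (m ∸ i)) gx x (proj₁ coordinates)) (isolate (+ (i ∸ 1)) gy y (proj₂ coordinates))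
          (Equivalence.to (CQ-lin gx gy) γ∈C)
        where
        coordinates : x ≡ + (m ∸ i) ℤ.+ gx × y ≡ + (i ∸ 1) ℤ.+ gy
        coordinates = lin-injective (trans x≡ (lin-⊕ (+ (m ∸ i)) (+ (i ∸ 1)) gx gy))
        difference : ∀ c g → g ≡ (c ℤ.+ g) ℤ.- c
        difference = solve-∀
        isolate : ∀ c g x → x ≡ c ℤ.+ g → g ≡ x ℤ.- c
        isolate c g x refl = difference c g

  Frob⇔aboveCorner : 1 ℕ.≤ m → ∀ w →
    Frob gens w ⇔ (∃[ i ] (1 ℕ.≤ i × i ℕ.≤ m × ∃[ γ ] (CQ∩OK gens γ × w ≡ corner i ⊕ γ)))
  Frob⇔aboveCorner 1≤m = coords-elim
    (λ w → Frob gens w ⇔ (∃[ i ] (1 ℕ.≤ i × i ℕ.≤ m × ∃[ γ ] (CQ∩OK gens γ × w ≡ corner i ⊕ γ))))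
    (λ x y → AboveCorner-lin x y ⇔-∘
               (mk⇔ (isFrobenius⇒aboveCorner 1≤m {x} {y}) (aboveCorner⇒isFrobenius {x} {y}) ⇔-∘ Frob-lin x y))

  cone-𝟘 : CQ∩OK gens 𝟘
  cone-𝟘 = subst (CQ∩OK gens) (sym 𝟘≡) (Equivalence.from (CQ-lin 0ℤ 0ℤ) InCone-0)

  cone-⊕ : ∀ γ δ → CQ∩OK gens γ → CQ∩OK gens δ → CQ∩OK gens (γ ⊕ δ)
  cone-⊕ = coords-elim (λ γ → ∀ δ → CQ∩OK gens γ → CQ∩OK gens δ → CQ∩OK gens (γ ⊕ δ)) λ x y →
           coords-elim (λ δ → CQ∩OK gens (lin x y) → CQ∩OK gens δ → CQ∩OK gens (lin x y ⊕ δ)) λ x' y' γ∈C δ∈C →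
    subst (CQ∩OK gens) (sym (lin-⊕ x y x' y'))
      (Equivalence.from (CQ-lin (x ℤ.+ x') (y ℤ.+ y'))
        (InCone-+ (Equivalence.to (CQ-lin x y) γ∈C) (Equivalence.to (CQ-lin x' y') δ∈C)))

  corners-rigid-lin : ∀ {i j} gx gy dx dy → 1 ℕ.≤ i → i ℕ.≤ m → 1 ℕ.≤ j → j ℕ.≤ m →
    CQ∩OK gens (lin gx gy) → CQ∩OK gens (lin dx dy) →
    corner i ≡ (corner j ⊕ lin gx gy) ⊕ lin dx dy → i ≡ j × lin gx gy ≡ 𝟘
  corners-rigid-lin {i} {j} gx gy dx dy 1≤i i≤m 1≤j j≤m γ∈C δ∈C corner≡ =
    i≡j , trans (cong₂ lin gx≡0 gy≡0) (sym 𝟘≡)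
    where
    coordinates : + (m ∸ i) ≡ (+ (m ∸ j) ℤ.+ gx) ℤ.+ dx × + (i ∸ 1) ≡ (+ (j ∸ 1) ℤ.+ gy) ℤ.+ dy
    coordinates = lin-injective (trans corner≡ (trans
      (cong (_⊕ lin dx dy) (lin-⊕ (+ (m ∸ j)) (+ (j ∸ 1)) gx gy))
      (lin-⊕ (+ (m ∸ j) ℤ.+ gx) (+ (j ∸ 1) ℤ.+ gy) dx dy)))
    rigid : i ≡ j × gx ≡ 0ℤ × gy ≡ 0ℤ
    rigid = corners-rigid 1≤i i≤m 1≤j j≤m (Equivalence.to (CQ-lin gx gy) γ∈C)
              (Equivalence.to (CQ-lin dx dy) δ∈C) (proj₁ coordinates) (proj₂ coordinates)
    i≡j : i ≡ j
    i≡j = proj₁ rigid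
    gx≡0 : gx ≡ 0ℤ
    gx≡0 = proj₁ (proj₂ rigid)
    gy≡0 : gy ≡ 0ℤ
    gy≡0 = proj₂ (proj₂ rigid)

  corners-rigid-OK : ∀ {i j γ δ} → 1 ℕ.≤ i → i ℕ.≤ m → 1 ℕ.≤ j → j ℕ.≤ m →
    CQ∩OK gens γ → CQ∩OK gens δ → corner i ≡ (corner j ⊕ γ) ⊕ δ → i ≡ j × γ ≡ 𝟘
  corners-rigid-OK {i} {j} {γ} {δ} 1≤i i≤m 1≤j j≤m = coords-elim
    (λ γ → CQ∩OK gens γ → CQ∩OK gens δ → corner i ≡ (corner j ⊕ γ) ⊕ δ → i ≡ j × γ ≡ 𝟘)
    (λ gx gy → coords-elim
      (λ δ → CQ∩OK gens (lin gx gy) → CQ∩OK gens δ → corner i ≡ (corner j ⊕ lin gx gy) ⊕ δ → i ≡ j × lin gx gy ≡ 𝟘)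
      (λ dx dy → corners-rigid-lin gx gy dx dy 1≤i i≤m 1≤j j≤m) δ) γ

proposition17 : (K : RealQuadratic) (β₁ β₂ : OK) →
    InOK⁺ K β₁ → InOK⁺ K β₂ → IsZBasis β₁ β₂ → β₁ <[ K ] β₂ →
    (m : ℕ) → 1 ℕ.< m →
    let α = ((+ (ℕ.suc m)) ·ᶻ β₂) ⊝ ((+ m) ·ᶻ β₁)
        gens = triple β₁ β₂ α
    in (∀ w → 𝔐 gens w ⇔ (∃[ i ] (1 ℕ.≤ i × i ℕ.≤ m × w ≡ ((m ∸ i) ·ⁿ β₁) ⊕ ((i ∸ 1) ·ⁿ β₂))))
     × (∀ w → Frob gens w ⇔ (∃[ i ] (1 ℕ.≤ i × i ℕ.≤ m
              × ∃[ γ ] (CQ∩OK gens γ × w ≡ (((m ∸ i) ·ⁿ β₁) ⊕ ((i ∸ 1) ·ⁿ β₂)) ⊕ γ))))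
proposition17 K β₁ β₂ _ _ basis _ m 1<m =
  𝔐-of-corners gens m corner cone-𝟘 cone-⊕ frob⇔ corners-rigid-OK , frob⇔
  where
  open Triple basis m
  frob⇔ : ∀ w → Frob gens w ⇔ (∃[ i ] (1 ℕ.≤ i × i ℕ.≤ m × ∃[ γ ] (CQ∩OK gens γ × w ≡ corner i ⊕ γ)))
  frob⇔ = Frob⇔aboveCorner (ℕP.<⇒≤ 1<m)
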